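{- The matching polynomials of simple graphs with a pendant edge are polynomial reconstructible: if $G$ and $H$ are simple graphs, each having a vertex of degree $1$, and $\mathcal{D}_M(G)=\mathcal{D}_M(H)$ as multisets, then $M(G,x,y)=M(H,x,y)$.
   Context: A matching in $G=(V,E)$ is a set $A\subseteq E$ of edges no two of which share a vertex. The matching polynomial is $M(G,x,y)=\sum_{A} x^{\mathrm{md}(G,A)}y^{|A|}$, the sum over all matchings $A$ of $G$, where $\mathrm{md}(G,A)$ is the number of vertices of $G$ not covered by $A$. For $v\in V$, $G_{ -v}$ is the graph obtained by deleting $v$ and its incident edges. The polynomial deck is the multiset $\mathcal{D}_M(G)=\{M(G_{ -v},x,y): v\in V\}$. A class of graphs has polynomial reconstructible matching polynomials if, within the class, $M(G,x,y)$ is determined by $\mathcal{D}_M(G)$. -}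

module Defs where

open import Data.Bool using (Bool; true; false; if_then_else_; _∧_; _∨_; not)
open import Data.Nat using (ℕ; zero; suc; _+_; _≡ᵇ_)
open import Data.Fin using (Fin; punchIn; toℕ; _<?_)
open import Data.Fin.Properties using (_≟_)
open import Data.List using (List; []; _∷_; length; map; filter; concatMap; allFin; _++_)
open import Data.Nat.ListAction using (sum)
open import Data.Bool.ListAction using (any; all)
open import Data.Product using (_×_; _,_; proj₁; proj₂; Σ)
open import Relation.Nullary.Decidable using (⌊_⌋)
open import Relation.Binary.PropositionalEquality using (_≡_)
open import Function.Bundles using (_↔_; Inverse)

record Graph (n : ℕ) : Set where
  field
    adj    : Fin n → Fin n → Bool
    sym    : ∀ u v → adj u v ≡ adj v u
    irrefl : ∀ v → adj v v ≡ false
open Graph public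

degree : ∀ {n} → Graph n → Fin n → ℕ
degree {n} G v = sum (map (λ u → if adj G v u then 1 else 0) (allFin n))

HasPendant : ∀ {n} → Graph n → Set
HasPendant {n} G = Σ (Fin n) (λ v → degree G v ≡ 1)

-- vertex-deleted subgraph G_{-v}: vertices of Fin n are relabelled into Fin (suc n) ∖ {v}
delete : ∀ {n} → Graph (suc n) → Fin (suc n) → Graph n
delete G v = record
  { adj    = λ i j → adj G (punchIn v i) (punchIn v j)
  ; sym    = λ i j → sym G (punchIn v i) (punchIn v j)
  ; irrefl = λ i → irrefl G (punchIn v i) }

Edge : ℕ → Set
Edge n = Fin n × Fin n

bfilter : ∀ {A : Set} → (A → Bool) → List A → List A
bfilter p [] = []
bfilter p (x ∷ xs) = if p x then x ∷ bfilter p xs else bfilter p xs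

-- edge list: each edge {i,j} listed exactly once, as (i , j) with i < j
edges : ∀ {n} → Graph n → List (Edge n)
edges {n} G =
  bfilter (λ e → ⌊ proj₁ e <? proj₂ e ⌋ ∧ adj G (proj₁ e) (proj₂ e))
          (concatMap (λ i → map (λ j → (i , j)) (allFin n)) (allFin n))

sublists : ∀ {A : Set} → List A → List (List A)
sublists [] = [] ∷ []
sublists (x ∷ xs) = sublists xs ++ map (x ∷_) (sublists xs)

covers : ∀ {n} → Edge n → Fin n → Bool
covers (i , j) v = ⌊ i ≟ v ⌋ ∨ ⌊ j ≟ v ⌋

meets : ∀ {n} → Edge n → Edge n → Bool
meets e (i , j) = covers e i ∨ covers e j

isMatching : ∀ {n} → List (Edge n) → Bool
isMatching [] = true
isMatching (e ∷ es) = all (λ f → not (meets e f)) es ∧ isMatching es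

matchings : ∀ {n} → Graph n → List (List (Edge n))
matchings G = bfilter isMatching (sublists (edges G))

md : ∀ {n} → List (Edge n) → ℕ
md {n} A = length (bfilter (λ v → not (any (λ e → covers e v) A)) (allFin n))

-- The matching polynomial M(G,x,y) = Σ_A x^{md(G,A)} y^{|A|}, a polynomial in ℕ[x,y],
-- represented by its coefficient function: coeff i k = coefficient of x^i y^k
-- = number of matchings A with md(G,A) = i and |A| = k.
Poly₂ : Set
Poly₂ = ℕ → ℕ → ℕ

matchingPoly : ∀ {n} → Graph n → Poly₂
matchingPoly G i k =
  length (bfilter (λ A → (md A ≡ᵇ i) ∧ (length A ≡ᵇ k)) (matchings G))

_≈P_ : Poly₂ → Poly₂ → Set
p ≈P q = ∀ i k → p i k ≡ q i k

-- equality of polynomial decks as multisets: a bijection between the vertex sets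
-- matching up cards with equal polynomials
SameDeck : ∀ {n m} → Graph (suc n) → Graph (suc m) → Set
SameDeck {n} {m} G H =
  Σ (Fin (suc n) ↔ Fin (suc m)) (λ σ →
     ∀ v → matchingPoly (delete G v) ≈P matchingPoly (delete H (Inverse.to σ v)))

-- Write M_{i,k}(G) for the coefficient of x^i y^k in M(G). A matching leaving i+1 vertices uncovered survives
-- in exactly i+1 cards, so Σ_v M_{i,k}(G − v) = (i+1) M_{i+1,k}(G) and the deck determines every coefficient
-- with i ≥ 1. As G has a vertex, M_{0,0}(G) = 0, and only the numbers M_{0,k+1}(G) of perfect matchings remain.
-- Removing the edge at w from a perfect matching is an injection into the matchings of G − w missing one
-- vertex, so M_{0,k+1}(G) ≤ M_{1,k}(G − w) for every w. When w is the neighbour of a pendant vertex v, the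
-- vertex v is isolated in G − w and adding the edge vw inverts this map, so equality holds. Comparing with the
-- card of H at such a neighbour gives M_{0,k+1}(G) ≤ M_{0,k+1}(H), and the reverse inequality by symmetry.

module Submission where

open import Defs hiding (sym)

open import Algebra.Bundles using (CommutativeMonoid; CommutativeSemigroup)
import Algebra.Properties.CommutativeMonoid.Sum as MonoidSum
open import Algebra.Properties.CommutativeSemigroup using (interchange; x∙yz≈y∙xz)
open import Data.Bool using (Bool; true; false; if_then_else_; _∧_; _∨_; not; T)
open import Data.Bool.ListAction using (and; or; any; all)
open import Data.Bool.Properties
  using (T-≡; ∧-identityʳ; ∧-zeroʳ; ∨-zeroʳ; ∧-commutativeMonoid; ∨-commutativeMonoid; ∨-∧-booleanAlgebra)
open import Algebra.Lattice.Properties.BooleanAlgebra ∨-∧-booleanAlgebra using (deMorgan₂)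
open import Data.Empty using (⊥; ⊥-elim)
open import Data.Fin using (Fin; zero; suc; punchIn; _<?_; _<_)
open import Data.Fin.Properties
  using (_≟_; <-irrefl; <-asym; <-cmp; ≤∧≢⇒<; <⇒≢; punchIn-injective; punchInᵢ≢i; punchIn-mono-≤; punchIn-cancel-≤)
open import Data.List
  using (List; []; _∷_; [_]; _++_; length; map; concatMap; allFin; tabulate; filterᵇ; cartesianProduct)
open import Data.List.Membership.Propositional using (_∈_)
open import Data.List.Membership.Propositional.Properties using (∈-filter⁻)
open import Data.List.Properties
  using (map-∘; map-++; map-cong; length-map; map-tabulate; concatMap-cong; concatMap-map; map-concatMap)
open import Data.List.Relation.Binary.Permutation.Propositional
  using (_↭_; prep; swap; ↭-sym) renaming (refl to ↭-refl; trans to ↭-trans)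
open import Data.List.Relation.Binary.Permutation.Propositional.Properties using (shift; ↭-length)
import Data.List.Relation.Unary.All as All
open import Data.List.Relation.Unary.AllPairs using (_∷_)
open import Data.List.Relation.Unary.Any using (here; there)
open import Data.List.Relation.Unary.Unique.Propositional using (Unique; [])
import Data.List.Relation.Unary.Unique.Propositional.Properties as Unique
open import Data.Nat using (ℕ; zero; suc; _+_; _*_; _≤_; _≡ᵇ_; z≤n; s≤s)
open import Data.Nat.ListAction using (sum)
open import Data.Nat.Properties
  using (+-0-commutativeMonoid; +-commutativeSemigroup; +-assoc; +-comm; +-identityʳ; +-mono-≤; *-zeroʳ; *-identityʳ;
         *-distribˡ-+; *-cancelˡ-≡; 1+n≢0; ≡ᵇ⇒≡; <⇒≤; ≤-reflexive; ≤-antisym; module ≤-Reasoning)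
open import Data.Product using (Σ; _×_; _,_; proj₁; proj₂)
open import Data.Sum using (_⊎_; inj₁; inj₂)
open import Data.Unit using (tt)
open import Function using (_∘_; id)
open import Function.Bundles using (_↔_; _⇔_; Inverse; Equivalence; mk⇔)
open import Function.Properties.Inverse using (↔-sym)
open import Level using (0ℓ)
open import Relation.Binary.Core using (_Preserves_⟶_)
open import Relation.Binary.Definitions using (tri<; tri≈; tri>)
open import Relation.Binary.PropositionalEquality hiding ([_])
open import Relation.Nullary.Decidable
  using (Dec; yes; no; T?; ⌊_⌋; isYes≗does; does-⇔; dec-true; dec-false; toWitness)
open import Relation.Nullary.Negation using (¬_)

private
  variable
    A B : Set

∧-commutativeSemigroup ∨-commutativeSemigroup : CommutativeSemigroup 0ℓ 0ℓ
∧-commutativeSemigroup = CommutativeMonoid.commutativeSemigroup ∧-commutativeMonoid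
∨-commutativeSemigroup = CommutativeMonoid.commutativeSemigroup ∨-commutativeMonoid

⟦_⟧ : Bool → ℕ
⟦ b ⟧ = if b then 1 else 0

if⟦⟧≡⟦∧⟧ : ∀ a {b} → (if a then ⟦ b ⟧ else 0) ≡ ⟦ a ∧ b ⟧
if⟦⟧≡⟦∧⟧ true  = refl
if⟦⟧≡⟦∧⟧ false = refl

∧-true : ∀ {a b} → a ∧ b ≡ true → a ≡ true × b ≡ true
∧-true {true} {true} _ = refl , refl

≡ᵇ-true : ∀ {m n} → (m ≡ᵇ n) ≡ true → m ≡ n
≡ᵇ-true {m} {n} eq = ≡ᵇ⇒≡ m n (subst T (sym eq) tt)

⌊⌋-⇔ : ∀ {P Q : Set} → P ⇔ Q → (p? : Dec P) (q? : Dec Q) → ⌊ p? ⌋ ≡ ⌊ q? ⌋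
⌊⌋-⇔ P⇔Q p? q? = trans (isYes≗does p?) (trans (does-⇔ P⇔Q p? q?) (sym (isYes≗does q?)))

⌊⌋-yes : ∀ {P : Set} (p? : Dec P) → P → ⌊ p? ⌋ ≡ true
⌊⌋-yes p? p = trans (isYes≗does p?) (dec-true p? p)

⌊⌋-no : ∀ {P : Set} (p? : Dec P) → ¬ P → ⌊ p? ⌋ ≡ false
⌊⌋-no p? ¬p = trans (isYes≗does p?) (dec-false p? ¬p)

⌊⌋-yes⁻ : ∀ {P : Set} (p? : Dec P) → ⌊ p? ⌋ ≡ true → P
⌊⌋-yes⁻ p? eq = toWitness (subst T (sym eq) tt)

≟-sym : ∀ {n} (x y : Fin n) → ⌊ x ≟ y ⌋ ≡ ⌊ y ≟ x ⌋
≟-sym x y = ⌊⌋-⇔ (mk⇔ sym sym) (x ≟ y) (y ≟ x)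

≟-punchIn : ∀ {n} (w : Fin (suc n)) (i j : Fin n) → ⌊ punchIn w i ≟ punchIn w j ⌋ ≡ ⌊ i ≟ j ⌋
≟-punchIn w i j = ⌊⌋-⇔ (mk⇔ (punchIn-injective w i j) (cong (punchIn w))) (punchIn w i ≟ punchIn w j) (i ≟ j)

<?-punchIn : ∀ {n} (w : Fin (suc n)) (i j : Fin n) → ⌊ punchIn w i <? punchIn w j ⌋ ≡ ⌊ i <? j ⌋
<?-punchIn w i j = ⌊⌋-⇔ (mk⇔ cancel mono) (punchIn w i <? punchIn w j) (i <? j)
  where
  cancel : punchIn w i < punchIn w j → i < j
  cancel lt = ≤∧≢⇒< (punchIn-cancel-≤ w i j (<⇒≤ lt)) (<⇒≢ lt ∘ cong (punchIn w))
  mono : i < j → punchIn w i < punchIn w j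
  mono lt = ≤∧≢⇒< (punchIn-mono-≤ w i j (<⇒≤ lt)) (<⇒≢ lt ∘ punchIn-injective w i j)

sumOver : (A → ℕ) → List A → ℕ
sumOver f []       = 0
sumOver f (x ∷ xs) = f x + sumOver f xs

syntax sumOver (λ x → e) xs = ∑[ x ∈ xs ] e

sumOver-cong : ∀ {f g : A → ℕ} xs → (∀ x → f x ≡ g x) → sumOver f xs ≡ sumOver g xs
sumOver-cong []       f≗g = refl
sumOver-cong (x ∷ xs) f≗g = cong₂ _+_ (f≗g x) (sumOver-cong xs f≗g)

sumOver-mono : ∀ {f g : A → ℕ} xs → (∀ x → f x ≤ g x) → sumOver f xs ≤ sumOver g xs
sumOver-mono []       f≤g = z≤n
sumOver-mono (x ∷ xs) f≤g = +-mono-≤ (f≤g x) (sumOver-mono xs f≤g)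

sumOver-zero : ∀ (xs : List A) → ∑[ x ∈ xs ] 0 ≡ 0
sumOver-zero []       = refl
sumOver-zero (x ∷ xs) = sumOver-zero xs

sumOver-distrib-+ : ∀ (f g : A → ℕ) xs → ∑[ x ∈ xs ] (f x + g x) ≡ sumOver f xs + sumOver g xs
sumOver-distrib-+ f g []       = refl
sumOver-distrib-+ f g (x ∷ xs) rewrite sumOver-distrib-+ f g xs =
  interchange +-commutativeSemigroup (f x) (g x) (sumOver f xs) (sumOver g xs)

sumOver-*ˡ : ∀ c (f : A → ℕ) xs → ∑[ x ∈ xs ] (c * f x) ≡ c * sumOver f xs
sumOver-*ˡ c f []       = sym (*-zeroʳ c)
sumOver-*ˡ c f (x ∷ xs) rewrite sumOver-*ˡ c f xs = sym (*-distribˡ-+ c (f x) _)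

sumOver-++ : ∀ (f : A → ℕ) xs ys → sumOver f (xs ++ ys) ≡ sumOver f xs + sumOver f ys
sumOver-++ f []       ys = refl
sumOver-++ f (x ∷ xs) ys rewrite sumOver-++ f xs ys = sym (+-assoc (f x) _ _)

sumOver-bfilter : ∀ (f : A → ℕ) p xs → sumOver f (bfilter p xs) ≡ ∑[ x ∈ xs ] (if p x then f x else 0)
sumOver-bfilter f p []       = refl
sumOver-bfilter f p (x ∷ xs) with p x
... | true  = cong (f x +_) (sumOver-bfilter f p xs)
... | false = sumOver-bfilter f p xs

length-bfilter : ∀ p (xs : List A) → length (bfilter p xs) ≡ ∑[ x ∈ xs ] ⟦ p x ⟧
length-bfilter p []       = refl
length-bfilter p (x ∷ xs) with p x
... | true  = cong suc (length-bfilter p xs)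
... | false = length-bfilter p xs

sum-map : ∀ (f : A → ℕ) xs → sum (map f xs) ≡ sumOver f xs
sum-map f []       = refl
sum-map f (x ∷ xs) = cong (f x +_) (sum-map f xs)

sumOver-map : ∀ (f : B → ℕ) (g : A → B) xs → sumOver f (map g xs) ≡ sumOver (f ∘ g) xs
sumOver-map f g []       = refl
sumOver-map f g (x ∷ xs) = cong (f (g x) +_) (sumOver-map f g xs)

sumOver-concatMap : ∀ (f : B → ℕ) (g : A → List B) xs →
  sumOver f (concatMap g xs) ≡ ∑[ x ∈ xs ] sumOver f (g x)
sumOver-concatMap f g []       = refl
sumOver-concatMap f g (x ∷ xs) =
  trans (sumOver-++ f (g x) _) (cong (sumOver f (g x) +_) (sumOver-concatMap f g xs))

sumOver-comm : ∀ (h : A → B → ℕ) xs ys →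
  ∑[ x ∈ xs ] ∑[ y ∈ ys ] h x y ≡ ∑[ y ∈ ys ] ∑[ x ∈ xs ] h x y
sumOver-comm h []       ys = sym (sumOver-zero ys)
sumOver-comm h (x ∷ xs) ys rewrite sumOver-comm h xs ys =
  sym (sumOver-distrib-+ (h x) (λ y → ∑[ x ∈ xs ] h x y) ys)

sumOver-≤-atMostOne : ∀ (q : A → Bool) d {xs} → Unique xs →
  (∀ {x} → x ∈ xs → q x ≡ true → d ≡ true) →
  (∀ {x y} → x ∈ xs → y ∈ xs → q x ≡ true → q y ≡ true → x ≡ y) →
  ∑[ x ∈ xs ] ⟦ q x ⟧ ≤ ⟦ d ⟧
sumOver-≤-atMostOne q d []                 _   _    = z≤n
sumOver-≤-atMostOne q d {x ∷ xs} (x∉xs ∷ u) q⇒d q-inj with q x in qx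
... | false = sumOver-≤-atMostOne q d u (q⇒d ∘ there) (λ y∈ z∈ → q-inj (there y∈) (there z∈))
... | true rewrite q⇒d (here refl) qx = s≤s (≤-reflexive (rest-zero xs (λ y∈ → y∈)))
  where
  rest-zero : ∀ ys → (∀ {y} → y ∈ ys → y ∈ xs) → ∑[ y ∈ ys ] ⟦ q y ⟧ ≡ 0
  rest-zero []       _   = refl
  rest-zero (y ∷ ys) sub with q y in qy
  ... | true  = ⊥-elim (All.lookup x∉xs (sub (here refl)) (q-inj (here refl) (there (sub (here refl))) qx qy))
  ... | false = rest-zero ys (sub ∘ there)

module ℕSum = MonoidSum +-0-commutativeMonoid

sumOver-tabulate : ∀ {n} (f : A → ℕ) (g : Fin n → A) → sumOver f (tabulate g) ≡ ℕSum.sum (f ∘ g)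
sumOver-tabulate {n = zero}  f g = refl
sumOver-tabulate {n = suc n} f g = cong (f (g zero) +_) (sumOver-tabulate f (g ∘ suc))

sumOver-allFin-punchIn : ∀ {n} (w : Fin (suc n)) (f : Fin (suc n) → ℕ) →
  sumOver f (allFin (suc n)) ≡ f w + sumOver (f ∘ punchIn w) (allFin n)
sumOver-allFin-punchIn w f = begin
  sumOver f (allFin _)                   ≡⟨ sumOver-tabulate f id ⟩
  ℕSum.sum f                             ≡⟨ ℕSum.sum-remove {i = w} f ⟩
  f w + ℕSum.sum (f ∘ punchIn w)         ≡⟨ cong (f w +_) (sumOver-tabulate (f ∘ punchIn w) id) ⟨
  f w + sumOver (f ∘ punchIn w) (allFin _) ∎
  where open ≡-Reasoning

sumOver-allFin-permute : ∀ {m n} (σ : Fin m ↔ Fin n) (f : Fin n → ℕ) →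
  sumOver (f ∘ Inverse.to σ) (allFin m) ≡ sumOver f (allFin n)
sumOver-allFin-permute σ f = begin
  sumOver (f ∘ Inverse.to σ) (allFin _) ≡⟨ sumOver-tabulate (f ∘ Inverse.to σ) id ⟩
  ℕSum.sum (f ∘ Inverse.to σ)           ≡⟨ ℕSum.∑-permute f σ ⟨
  ℕSum.sum f                            ≡⟨ sumOver-tabulate f id ⟨
  sumOver f (allFin _)                  ∎
  where open ≡-Reasoning

sumOver-allFin-single : ∀ {n} (y : Fin n) (f : Fin n → ℕ) →
  ∑[ x ∈ allFin n ] (if ⌊ y ≟ x ⌋ then f x else 0) ≡ f y
sumOver-allFin-single {suc n} y f
  rewrite sumOver-allFin-punchIn y (λ x → if ⌊ y ≟ x ⌋ then f x else 0) | ⌊⌋-yes (y ≟ y) refl =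
  trans (cong (f y +_) (trans (sumOver-cong (allFin n) off-y) (sumOver-zero (allFin n)))) (+-identityʳ (f y))
  where
  off-y : ∀ i → (if ⌊ y ≟ punchIn y i ⌋ then f (punchIn y i) else 0) ≡ 0
  off-y i rewrite ⌊⌋-no (y ≟ punchIn y i) (punchInᵢ≢i y i ∘ sym) = refl

bfilter-++ : ∀ p (xs ys : List A) → bfilter p (xs ++ ys) ≡ bfilter p xs ++ bfilter p ys
bfilter-++ p []       ys = refl
bfilter-++ p (x ∷ xs) ys with p x
... | true  = cong (x ∷_) (bfilter-++ p xs ys)
... | false = bfilter-++ p xs ys

bfilter-map : ∀ p (f : A → B) xs → bfilter p (map f xs) ≡ map f (bfilter (p ∘ f) xs)
bfilter-map p f []       = refl
bfilter-map p f (x ∷ xs) with p (f x)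
... | true  = cong (f x ∷_) (bfilter-map p f xs)
... | false = bfilter-map p f xs

bfilter-cong : ∀ {p q : A → Bool} xs → (∀ x → p x ≡ q x) → bfilter p xs ≡ bfilter q xs
bfilter-cong []       p≗q = refl
bfilter-cong {q = q} (x ∷ xs) p≗q rewrite p≗q x with q x
... | true  = cong (x ∷_) (bfilter-cong xs p≗q)
... | false = bfilter-cong xs p≗q

bfilter-false : ∀ (xs : List A) → bfilter (λ _ → false) xs ≡ []
bfilter-false []       = refl
bfilter-false (x ∷ xs) = bfilter-false xs

bfilter-true : ∀ (xs : List A) → bfilter (λ _ → true) xs ≡ xs
bfilter-true []       = refl
bfilter-true (x ∷ xs) = cong (x ∷_) (bfilter-true xs)

bfilter-comm : ∀ (p q : A → Bool) xs → bfilter p (bfilter q xs) ≡ bfilter q (bfilter p xs)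
bfilter-comm p q []       = refl
bfilter-comm p q (x ∷ xs) with p x in px | q x in qx
... | true  | true  rewrite px | qx = cong (x ∷_) (bfilter-comm p q xs)
... | true  | false rewrite qx      = bfilter-comm p q xs
... | false | true  rewrite px      = bfilter-comm p q xs
... | false | false                 = bfilter-comm p q xs

bfilter-product : ∀ (p : A → Bool) (q : B → Bool) xs ys →
  bfilter (λ e → p (proj₁ e) ∧ q (proj₂ e)) (concatMap (λ x → map (x ,_) ys) xs)
    ≡ concatMap (λ x → map (x ,_) (bfilter q ys)) (bfilter p xs)
bfilter-product p q []       ys = refl
bfilter-product p q (x ∷ xs) ys with p x in px
... | true  = trans (bfilter-++ _ (map (x ,_) ys) _)
                (cong₂ _++_ (trans (bfilter-map _ (x ,_) ys) (cong (map (x ,_)) (bfilter-cong ys (λ y → cong (_∧ q y) px))))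
                            (bfilter-product p q xs ys))
... | false = trans (bfilter-++ _ (map (x ,_) ys) _)
                (cong₂ _++_ (trans (bfilter-map _ (x ,_) ys)
                                   (cong (map (x ,_)) (trans (bfilter-cong ys (λ y → cong (_∧ q y) px)) (bfilter-false ys))))
                            (bfilter-product p q xs ys))

↭-bfilter-split : ∀ p (xs : List A) → xs ↭ bfilter p xs ++ bfilter (not ∘ p) xs
↭-bfilter-split p []       = ↭-refl
↭-bfilter-split p (x ∷ xs) with p x
... | true  = prep x (↭-bfilter-split p xs)
... | false = ↭-trans (prep x (↭-bfilter-split p xs)) (↭-sym (shift x (bfilter p xs) (bfilter (not ∘ p) xs)))

bfilter≡filterᵇ : ∀ (p : A → Bool) xs → bfilter p xs ≡ filterᵇ p xs
bfilter≡filterᵇ p []       = refl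
bfilter≡filterᵇ p (x ∷ xs) with p x
... | true  = cong (x ∷_) (bfilter≡filterᵇ p xs)
... | false = bfilter≡filterᵇ p xs

∈-bfilter⁻ : ∀ (p : A → Bool) {x} xs → x ∈ bfilter p xs → x ∈ xs × p x ≡ true
∈-bfilter⁻ p xs x∈ with ∈-filter⁻ (T? ∘ p) (subst (_ ∈_) (bfilter≡filterᵇ p xs) x∈)
... | x∈xs , px = x∈xs , Equivalence.to T-≡ px

Unique-bfilter : ∀ (p : A → Bool) {xs} → Unique xs → Unique (bfilter p xs)
Unique-bfilter p {xs} u = subst Unique (sym (bfilter≡filterᵇ p xs)) (Unique.filter⁺ (T? ∘ p) u)

all-↭ : ∀ (p : A → Bool) → all p Preserves _↭_ ⟶ _≡_
all-↭ p ↭-refl        = refl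
all-↭ p (prep x q)    = cong (p x ∧_) (all-↭ p q)
all-↭ p (swap x y q)  = trans (x∙yz≈y∙xz ∧-commutativeSemigroup (p x) (p y) _) (cong (λ b → p y ∧ (p x ∧ b)) (all-↭ p q))
all-↭ p (↭-trans q r) = trans (all-↭ p q) (all-↭ p r)

any-↭ : ∀ (p : A → Bool) → any p Preserves _↭_ ⟶ _≡_
any-↭ p ↭-refl        = refl
any-↭ p (prep x q)    = cong (p x ∨_) (any-↭ p q)
any-↭ p (swap x y q)  = trans (x∙yz≈y∙xz ∨-commutativeSemigroup (p x) (p y) _) (cong (λ b → p y ∨ (p x ∨ b)) (any-↭ p q))
any-↭ p (↭-trans q r) = trans (any-↭ p q) (any-↭ p r)

any-map : ∀ (p : B → Bool) (f : A → B) xs → any p (map f xs) ≡ any (p ∘ f) xs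
any-map p f xs = cong or (sym (map-∘ xs))

all-map : ∀ (p : B → Bool) (f : A → B) xs → all p (map f xs) ≡ all (p ∘ f) xs
all-map p f xs = cong and (sym (map-∘ xs))

any-cong : ∀ {p q : A → Bool} xs → (∀ x → p x ≡ q x) → any p xs ≡ any q xs
any-cong xs p≗q = cong or (map-cong p≗q xs)

all-cong : ∀ {p q : A → Bool} xs → (∀ x → p x ≡ q x) → all p xs ≡ all q xs
all-cong xs p≗q = cong and (map-cong p≗q xs)

any-false : ∀ (xs : List A) → any (λ _ → false) xs ≡ false
any-false []       = refl
any-false (x ∷ xs) = any-false xs

all-∧ : ∀ (p q : A → Bool) xs → all (λ x → p x ∧ q x) xs ≡ all p xs ∧ all q xs
all-∧ p q []       = refl
all-∧ p q (x ∷ xs) rewrite all-∧ p q xs = interchange ∧-commutativeSemigroup (p x) (q x) (all p xs) (all q xs)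

sublists-map : ∀ (f : A → B) xs → sublists (map f xs) ≡ map (map f) (sublists xs)
sublists-map f []       = refl
sublists-map f (x ∷ xs) rewrite sublists-map f xs =
  sym (trans (map-++ (map f) (sublists xs) _)
             (cong (map (map f) (sublists xs) ++_) (trans (sym (map-∘ (sublists xs))) (map-∘ (sublists xs)))))

sumOver-sublists-∷ : ∀ (f : List A → ℕ) x xs →
  sumOver f (sublists (x ∷ xs)) ≡ sumOver f (sublists xs) + ∑[ B ∈ sublists xs ] f (x ∷ B)
sumOver-sublists-∷ f x xs =
  trans (sumOver-++ f (sublists xs) _) (cong (sumOver f (sublists xs) +_) (sumOver-map f (x ∷_) (sublists xs)))

private
  SublistSumsAgree : List A → List A → Set
  SublistSumsAgree {A} xs ys = ∀ (f : List A → ℕ) → f Preserves _↭_ ⟶ _≡_ →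
    sumOver f (sublists xs) ≡ sumOver f (sublists ys)

  agree-∷ : ∀ (x : A) {xs ys} → SublistSumsAgree xs ys → SublistSumsAgree (x ∷ xs) (x ∷ ys)
  agree-∷ x {xs} {ys} agree f f-inv = begin
    sumOver f (sublists (x ∷ xs))
      ≡⟨ sumOver-sublists-∷ f x xs ⟩
    sumOver f (sublists xs) + ∑[ B ∈ sublists xs ] f (x ∷ B)
      ≡⟨ cong₂ _+_ (agree f f-inv) (agree (f ∘ (x ∷_)) (f-inv ∘ prep x)) ⟩
    sumOver f (sublists ys) + ∑[ B ∈ sublists ys ] f (x ∷ B)
      ≡⟨ sumOver-sublists-∷ f x ys ⟨
    sumOver f (sublists (x ∷ ys)) ∎
    where open ≡-Reasoning

  agree-swap : ∀ (x y : A) xs → SublistSumsAgree (x ∷ y ∷ xs) (y ∷ x ∷ xs)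
  agree-swap x y xs f f-inv = begin
    sumOver f (sublists (x ∷ y ∷ xs))
      ≡⟨ expand x y ⟩
    (σ f + σ (f ∘ (y ∷_))) + (σ (f ∘ (x ∷_)) + σ (λ B → f (x ∷ y ∷ B)))
      ≡⟨ cong (λ s → (σ f + σ (f ∘ (y ∷_))) + (σ (f ∘ (x ∷_)) + s))
              (sumOver-cong (sublists xs) (λ B → f-inv (swap x y ↭-refl))) ⟩
    (σ f + σ (f ∘ (y ∷_))) + (σ (f ∘ (x ∷_)) + σ (λ B → f (y ∷ x ∷ B)))
      ≡⟨ interchange +-commutativeSemigroup (σ f) _ _ _ ⟩
    (σ f + σ (f ∘ (x ∷_))) + (σ (f ∘ (y ∷_)) + σ (λ B → f (y ∷ x ∷ B)))
      ≡⟨ expand y x ⟨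
    sumOver f (sublists (y ∷ x ∷ xs)) ∎
    where
    open ≡-Reasoning
    σ : (List _ → ℕ) → ℕ
    σ g = sumOver g (sublists xs)
    expand : ∀ a b →
      sumOver f (sublists (a ∷ b ∷ xs)) ≡ (σ f + σ (f ∘ (b ∷_))) + (σ (f ∘ (a ∷_)) + σ (λ B → f (a ∷ b ∷ B)))
    expand a b = trans (sumOver-sublists-∷ f a (b ∷ xs))
                       (cong₂ _+_ (sumOver-sublists-∷ f b xs) (sumOver-sublists-∷ (f ∘ (a ∷_)) b xs))

sumOver-sublists-↭ : ∀ {xs ys : List A} → xs ↭ ys → (f : List A → ℕ) → f Preserves _↭_ ⟶ _≡_ →
  sumOver f (sublists xs) ≡ sumOver f (sublists ys)
sumOver-sublists-↭ ↭-refl _ _ = refl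
sumOver-sublists-↭ {xs = x ∷ xs} {x ∷ ys} (prep x p) = agree-∷ x {xs} {ys} (sumOver-sublists-↭ p)
sumOver-sublists-↭ {xs = x ∷ y ∷ xs} {y ∷ x ∷ ys} (swap x y p) f f-inv =
  trans (agree-∷ x {y ∷ xs} {y ∷ ys} (agree-∷ y {xs} {ys} (sumOver-sublists-↭ p)) f f-inv) (agree-swap x y ys f f-inv)
sumOver-sublists-↭ (↭-trans p q) f f-inv = trans (sumOver-sublists-↭ p f f-inv) (sumOver-sublists-↭ q f f-inv)

restrict : (A → Bool) → (List A → ℕ) → List A → ℕ
restrict p f B = if all p B then f B else 0

sumOver-sublists-bfilter : ∀ p (f : List A → ℕ) ys →
  sumOver f (sublists (bfilter p ys)) ≡ sumOver (restrict p f) (sublists ys)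
sumOver-sublists-bfilter p f []       = refl
sumOver-sublists-bfilter p f (y ∷ ys) with p y in py
... | true  = begin
  sumOver f (sublists (y ∷ bfilter p ys))
    ≡⟨ sumOver-sublists-∷ f y (bfilter p ys) ⟩
  sumOver f (sublists (bfilter p ys)) + ∑[ B ∈ sublists (bfilter p ys) ] f (y ∷ B)
    ≡⟨ cong₂ _+_ (sumOver-sublists-bfilter p f ys) (sumOver-sublists-bfilter p (f ∘ (y ∷_)) ys) ⟩
  sumOver (restrict p f) (sublists ys) + sumOver (restrict p (f ∘ (y ∷_))) (sublists ys)
    ≡⟨ cong (sumOver (restrict p f) (sublists ys) +_) (sumOver-cong (sublists ys) restrict-∷) ⟩
  sumOver (restrict p f) (sublists ys) + ∑[ B ∈ sublists ys ] restrict p f (y ∷ B)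
    ≡⟨ sumOver-sublists-∷ (restrict p f) y ys ⟨
  sumOver (restrict p f) (sublists (y ∷ ys)) ∎
  where
  open ≡-Reasoning
  restrict-∷ : ∀ B → restrict p (f ∘ (y ∷_)) B ≡ restrict p f (y ∷ B)
  restrict-∷ B = cong (λ b → if b ∧ all p B then f (y ∷ B) else 0) (sym py)
... | false = begin
  sumOver f (sublists (bfilter p ys))
    ≡⟨ sumOver-sublists-bfilter p f ys ⟩
  sumOver (restrict p f) (sublists ys)
    ≡⟨ +-identityʳ _ ⟨
  sumOver (restrict p f) (sublists ys) + 0
    ≡⟨ cong (sumOver (restrict p f) (sublists ys) +_) (sumOver-zero (sublists ys)) ⟨
  sumOver (restrict p f) (sublists ys) + ∑[ B ∈ sublists ys ] (if false ∧ all p B then f (y ∷ B) else 0)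
    ≡⟨ cong (λ b → sumOver (restrict p f) (sublists ys) + ∑[ B ∈ sublists ys ] (if b ∧ all p B then f (y ∷ B) else 0)) py ⟨
  sumOver (restrict p f) (sublists ys) + ∑[ B ∈ sublists ys ] restrict p f (y ∷ B)
    ≡⟨ sumOver-sublists-∷ (restrict p f) y ys ⟨
  sumOver (restrict p f) (sublists (y ∷ ys)) ∎
  where open ≡-Reasoning

sumOver-sublists-bfilter-mono : ∀ p {f g : List A → ℕ} ys → (∀ B → all p B ≡ true → f B ≤ g B) →
  sumOver f (sublists (bfilter p ys)) ≤ sumOver g (sublists (bfilter p ys))
sumOver-sublists-bfilter-mono p {f} {g} ys f≤g =
  subst₂ _≤_ (sym (sumOver-sublists-bfilter p f ys)) (sym (sumOver-sublists-bfilter p g ys))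
    (sumOver-mono (sublists ys) restricted)
  where
  restricted : ∀ B → restrict p f B ≤ restrict p g B
  restricted B with all p B in pB
  ... | true  = f≤g B pB
  ... | false = z≤n

sumOver-sublists-bfilter-cong : ∀ p {f g : List A → ℕ} ys → (∀ B → all p B ≡ true → f B ≡ g B) →
  sumOver f (sublists (bfilter p ys)) ≡ sumOver g (sublists (bfilter p ys))
sumOver-sublists-bfilter-cong p {f} {g} ys f≡g =
  trans (sumOver-sublists-bfilter p f ys) (trans (sumOver-cong (sublists ys) restricted) (sym (sumOver-sublists-bfilter p g ys)))
  where
  restricted : ∀ B → restrict p f B ≡ restrict p g B
  restricted B with all p B in pB
  ... | true  = f≡g B pB
  ... | false = refl

sumOver-sublists-++ : ∀ (f : List A → ℕ) xs ys →
  sumOver f (sublists (xs ++ ys)) ≡ ∑[ B ∈ sublists xs ] ∑[ C ∈ sublists ys ] f (B ++ C)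
sumOver-sublists-++ f []       ys = sym (+-identityʳ _)
sumOver-sublists-++ f (x ∷ xs) ys =
  trans (sumOver-sublists-∷ f x (xs ++ ys))
    (trans (cong₂ _+_ (sumOver-sublists-++ f xs ys) (sumOver-sublists-++ (f ∘ (x ∷_)) xs ys))
      (sym (sumOver-sublists-∷ (λ B → ∑[ C ∈ sublists ys ] f (B ++ C)) x xs)))

sumOver-sublists-singletons : ∀ (h : List A → ℕ) → (∀ B → length B ≢ 1 → h B ≡ 0) →
  ∀ xs → sumOver h (sublists xs) ≡ ∑[ x ∈ xs ] h [ x ]
sumOver-sublists-singletons h h-vanishes []       = trans (+-identityʳ _) (h-vanishes [] λ ())
sumOver-sublists-singletons h h-vanishes (x ∷ xs) =
  trans (sumOver-sublists-∷ h x xs)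
    (trans (cong₂ _+_ (sumOver-sublists-singletons h h-vanishes xs) (only-[] xs))
      (+-comm _ (h [ x ])))
  where
  only-[] : ∀ ys → ∑[ B ∈ sublists ys ] h (x ∷ B) ≡ h [ x ]
  only-[] []       = +-identityʳ _
  only-[] (y ∷ ys) =
    trans (sumOver-sublists-∷ (h ∘ (x ∷_)) y ys)
      (trans (cong₂ _+_ (only-[] ys)
                        (trans (sumOver-cong (sublists ys) (λ B → h-vanishes (x ∷ y ∷ B) λ ())) (sumOver-zero (sublists ys))))
        (+-identityʳ _))

sumOver-sublists-bfilter-singletons : ∀ p (h : List A → ℕ) ys →
  (∀ B → all p B ≡ true → length B ≢ 1 → h B ≡ 0) →
  sumOver h (sublists (bfilter p ys)) ≡ ∑[ y ∈ bfilter p ys ] h [ y ]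
sumOver-sublists-bfilter-singletons p h ys h-vanishes = begin
  sumOver h (sublists (bfilter p ys))
    ≡⟨ sumOver-sublists-bfilter p h ys ⟩
  sumOver (restrict p h) (sublists ys)
    ≡⟨ sumOver-sublists-singletons (restrict p h) restrict-vanishes ys ⟩
  ∑[ y ∈ ys ] restrict p h [ y ]
    ≡⟨ sumOver-cong ys (λ y → cong (λ b → if b then h [ y ] else 0) (∧-identityʳ (p y))) ⟩
  ∑[ y ∈ ys ] (if p y then h [ y ] else 0)
    ≡⟨ sumOver-bfilter (h ∘ [_]) p ys ⟨
  ∑[ y ∈ bfilter p ys ] h [ y ] ∎
  where
  open ≡-Reasoning
  restrict-vanishes : ∀ B → length B ≢ 1 → restrict p h B ≡ 0
  restrict-vanishes B ≢1 with all p B in pB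
  ... | true  = h-vanishes B pB ≢1
  ... | false = refl

-- Matchings

avoids : ∀ {n} → Fin n → Edge n → Bool
avoids v e = not (covers e v)

uncovered : ∀ {n} → List (Edge n) → Fin n → Bool
uncovered A v = not (any (λ e → covers e v) A)

isMatching⟨_,_⟩ : ∀ {n} → ℕ → ℕ → List (Edge n) → Bool
isMatching⟨ i , k ⟩ A = isMatching A ∧ ((md A ≡ᵇ i) ∧ (length A ≡ᵇ k))

uncovered≡all-avoids : ∀ {n} (A : List (Edge n)) v → uncovered A v ≡ all (avoids v) A
uncovered≡all-avoids []      v = refl
uncovered≡all-avoids (e ∷ A) v with covers e v
... | true  = refl
... | false = uncovered≡all-avoids A v

md-sum : ∀ {n} (A : List (Edge n)) → md A ≡ ∑[ v ∈ allFin n ] ⟦ uncovered A v ⟧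
md-sum {n} A = length-bfilter (uncovered A) (allFin n)

md-↭ : ∀ {n} → md {n} Preserves _↭_ ⟶ _≡_
md-↭ {n} {A} {B} A↭B = trans (md-sum A)
  (trans (sumOver-cong (allFin n) (λ v → cong (λ b → ⟦ not b ⟧) (any-↭ (λ e → covers e v) A↭B))) (sym (md-sum B)))

meets-sym : ∀ {n} (e f : Edge n) → meets e f ≡ meets f e
meets-sym (i , j) (k , l) rewrite ≟-sym i k | ≟-sym i l | ≟-sym j k | ≟-sym j l =
  interchange ∨-commutativeSemigroup ⌊ k ≟ i ⌋ ⌊ k ≟ j ⌋ ⌊ l ≟ i ⌋ ⌊ l ≟ j ⌋

isMatching-↭ : ∀ {n} → isMatching {n} Preserves _↭_ ⟶ _≡_
isMatching-↭ ↭-refl        = refl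
isMatching-↭ (prep e q)    = cong₂ _∧_ (all-↭ _ q) (isMatching-↭ q)
isMatching-↭ (swap e f q)  =
  trans (cong (λ b → (not b ∧ _) ∧ _) (meets-sym e f))
    (trans (interchange ∧-commutativeSemigroup (not (meets f e)) _ _ _)
      (cong₂ _∧_ (cong (not (meets f e) ∧_) (all-↭ _ q)) (cong₂ _∧_ (all-↭ _ q) (isMatching-↭ q))))
isMatching-↭ (↭-trans q r) = trans (isMatching-↭ q) (isMatching-↭ r)

isMatching⟨⟩-↭ : ∀ {n} i k → isMatching⟨_,_⟩ {n} i k Preserves _↭_ ⟶ _≡_
isMatching⟨⟩-↭ i k A↭B =
  cong₂ _∧_ (isMatching-↭ A↭B) (cong₂ (λ a b → (a ≡ᵇ i) ∧ (b ≡ᵇ k)) (md-↭ A↭B) (↭-length A↭B))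

isMatching⟨⟩⇒md : ∀ {n i k} (A : List (Edge n)) → isMatching⟨ i , k ⟩ A ≡ true → md A ≡ i
isMatching⟨⟩⇒md A q = ≡ᵇ-true (proj₁ (∧-true (proj₂ (∧-true {isMatching A} q))))

uncovered⇒md≢0 : ∀ {n} (A : List (Edge n)) x → uncovered A x ≡ true → md A ≢ 0
uncovered⇒md≢0 {suc n} A x ux md≡0 = 1+n≢0 (begin
  suc (∑[ y ∈ allFin n ] ⟦ uncovered A (punchIn x y) ⟧)
    ≡⟨ cong (λ b → ⟦ b ⟧ + ∑[ y ∈ allFin n ] ⟦ uncovered A (punchIn x y) ⟧) ux ⟨
  ⟦ uncovered A x ⟧ + ∑[ y ∈ allFin n ] ⟦ uncovered A (punchIn x y) ⟧
    ≡⟨ sumOver-allFin-punchIn x (λ y → ⟦ uncovered A y ⟧) ⟨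
  ∑[ y ∈ allFin (suc n) ] ⟦ uncovered A y ⟧
    ≡⟨ md-sum A ⟨
  md A
    ≡⟨ md≡0 ⟩
  0 ∎)
  where open ≡-Reasoning

covers⇒endpoint : ∀ {n} (a b x : Fin n) → covers (a , b) x ≡ true → x ≡ a ⊎ x ≡ b
covers⇒endpoint a b x ab-covers-x with a ≟ x | b ≟ x | ab-covers-x
... | yes a≡x | _       | _ = inj₁ (sym a≡x)
... | no _    | yes b≡x | _ = inj₂ (sym b≡x)

meets-at : ∀ {n} (e f : Edge n) w → covers e w ≡ true → covers f w ≡ true → meets e f ≡ true
meets-at e (k , l) w e-covers f-covers with covers⇒endpoint k l w f-covers
... | inj₁ refl rewrite e-covers = refl
... | inj₂ refl rewrite e-covers = ∨-zeroʳ _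

not-meets : ∀ {n} (a b : Fin n) f → not (meets (a , b) f) ≡ avoids a f ∧ avoids b f
not-meets a b (k , l) rewrite ≟-sym a k | ≟-sym b k | ≟-sym a l | ≟-sym b l =
  trans (cong not (interchange ∨-commutativeSemigroup ⌊ k ≟ a ⌋ ⌊ k ≟ b ⌋ ⌊ l ≟ a ⌋ ⌊ l ≟ b ⌋))
        (deMorgan₂ (⌊ k ≟ a ⌋ ∨ ⌊ l ≟ a ⌋) (⌊ k ≟ b ⌋ ∨ ⌊ l ≟ b ⌋))

all-not-meets : ∀ {n} (a b : Fin n) C → all (λ f → not (meets (a , b) f)) C ≡ all (avoids a) C ∧ all (avoids b) C
all-not-meets a b C = trans (all-cong C (not-meets a b)) (all-∧ (avoids a) (avoids b) C)

sumOver-allFin-covers : ∀ {n} {a b : Fin n} → a ≢ b → ∑[ x ∈ allFin n ] ⟦ covers (a , b) x ⟧ ≡ 2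
sumOver-allFin-covers {n} {a} {b} a≢b = begin
  ∑[ x ∈ allFin n ] ⟦ ⌊ a ≟ x ⌋ ∨ ⌊ b ≟ x ⌋ ⟧
    ≡⟨ sumOver-cong (allFin n) (λ x → ⟦∨⟧ (⌊ a ≟ x ⌋) (⌊ b ≟ x ⌋) (not-both x)) ⟩
  ∑[ x ∈ allFin n ] (⟦ ⌊ a ≟ x ⌋ ⟧ + ⟦ ⌊ b ≟ x ⌋ ⟧)
    ≡⟨ sumOver-distrib-+ _ _ (allFin n) ⟩
  ∑[ x ∈ allFin n ] ⟦ ⌊ a ≟ x ⌋ ⟧ + ∑[ x ∈ allFin n ] ⟦ ⌊ b ≟ x ⌋ ⟧
    ≡⟨ cong₂ _+_ (sumOver-allFin-single a (λ _ → 1)) (sumOver-allFin-single b (λ _ → 1)) ⟩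
  2 ∎
  where
  open ≡-Reasoning
  ⟦∨⟧ : ∀ p q → (p ≡ true → q ≡ true → ⊥) → ⟦ p ∨ q ⟧ ≡ ⟦ p ⟧ + ⟦ q ⟧
  ⟦∨⟧ true  true  both = ⊥-elim (both refl refl)
  ⟦∨⟧ true  false _    = refl
  ⟦∨⟧ false q     _    = refl
  not-both : ∀ x → ⌊ a ≟ x ⌋ ≡ true → ⌊ b ≟ x ⌋ ≡ true → ⊥
  not-both x a≡x b≡x = a≢b (trans (⌊⌋-yes⁻ (a ≟ x) a≡x) (sym (⌊⌋-yes⁻ (b ≟ x) b≡x)))

md-∷ : ∀ {n} {a b : Fin n} → a ≢ b → ∀ C → all (avoids a) C ≡ true → all (avoids b) C ≡ true →
  md C ≡ 2 + md ((a , b) ∷ C)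
md-∷ {n} {a} {b} a≢b C avoids-a avoids-b = begin
  md C
    ≡⟨ md-sum C ⟩
  ∑[ x ∈ allFin n ] ⟦ uncovered C x ⟧
    ≡⟨ sumOver-cong (allFin n) split ⟩
  ∑[ x ∈ allFin n ] (⟦ covers (a , b) x ⟧ + ⟦ uncovered ((a , b) ∷ C) x ⟧)
    ≡⟨ sumOver-distrib-+ _ _ (allFin n) ⟩
  ∑[ x ∈ allFin n ] ⟦ covers (a , b) x ⟧ + ∑[ x ∈ allFin n ] ⟦ uncovered ((a , b) ∷ C) x ⟧
    ≡⟨ cong₂ _+_ (sumOver-allFin-covers a≢b) (sym (md-sum ((a , b) ∷ C))) ⟩
  2 + md ((a , b) ∷ C) ∎
  where
  open ≡-Reasoning
  split : ∀ x → ⟦ uncovered C x ⟧ ≡ ⟦ covers (a , b) x ⟧ + ⟦ uncovered ((a , b) ∷ C) x ⟧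
  split x with covers (a , b) x in ab-covers-x
  ... | false = refl
  ... | true with covers⇒endpoint a b x ab-covers-x
  ... | inj₁ refl rewrite uncovered≡all-avoids C a | avoids-a = refl
  ... | inj₂ refl rewrite uncovered≡all-avoids C b | avoids-b = refl

isMatching⟨⟩-∷ : ∀ {n} {a b : Fin n} {i k} → a ≢ b → ∀ C →
  isMatching⟨ i , suc k ⟩ ((a , b) ∷ C) ≡ (all (avoids a) C ∧ all (avoids b) C) ∧ isMatching⟨ 2 + i , k ⟩ C
isMatching⟨⟩-∷ {a = a} {b} a≢b C rewrite all-not-meets a b C
  with all (avoids a) C in avoids-a | all (avoids b) C in avoids-b
... | true  | true  rewrite md-∷ a≢b C avoids-a avoids-b = refl
... | true  | false = refl
... | false | _     = refl

md0⇒covers : ∀ {n} (e : Edge n) C x → md (e ∷ C) ≡ 0 → uncovered C x ≡ true → covers e x ≡ true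
md0⇒covers e C x md≡0 uncovered-x with covers e x in e-covers-x
... | true  = refl
... | false = ⊥-elim (uncovered⇒md≢0 (e ∷ C) x (trans (cong (λ b → not (b ∨ _)) e-covers-x) uncovered-x) md≡0)

meets⇒¬isMatching⟨⟩ : ∀ {n} (e f : Edge n) i k A → meets e f ≡ true → isMatching⟨ i , k ⟩ (e ∷ f ∷ A) ≡ false
meets⇒¬isMatching⟨⟩ e f i k A e-meets-f rewrite e-meets-f = refl

ordered-pair-≡ : ∀ {n} {a b a′ b′ : Fin n} → a < b → a′ < b′ →
  a′ ≡ a ⊎ a′ ≡ b → b′ ≡ a ⊎ b′ ≡ b → (a , b) ≡ (a′ , b′)
ordered-pair-≡ a<b a′<b′ (inj₁ refl) (inj₂ refl) = refl
ordered-pair-≡ a<b a′<b′ (inj₁ refl) (inj₁ refl) = ⊥-elim (<-irrefl refl a′<b′)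
ordered-pair-≡ a<b a′<b′ (inj₂ refl) (inj₂ refl) = ⊥-elim (<-irrefl refl a′<b′)
ordered-pair-≡ a<b a′<b′ (inj₂ refl) (inj₁ refl) = ⊥-elim (<-asym a<b a′<b′)

avoids⇒¬perfect : ∀ {n} {w : Fin n} {j} C → all (avoids w) C ≡ true → isMatching⟨ 0 , j ⟩ C ≡ false
avoids⇒¬perfect {w = w} C avoids-w with md C ≡ᵇ 0 in md≡ᵇ0
... | true  = ⊥-elim (uncovered⇒md≢0 C w (trans (uncovered≡all-avoids C w) avoids-w) (≡ᵇ-true md≡ᵇ0))
... | false = ∧-zeroʳ _

sumOver-sublists-avoiding-¬perfect : ∀ {n} (w : Fin n) j xs →
  ∑[ C ∈ sublists (bfilter (avoids w) xs) ] ⟦ isMatching⟨ 0 , j ⟩ C ⟧ ≡ 0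
sumOver-sublists-avoiding-¬perfect w j xs =
  trans (sumOver-sublists-bfilter-cong (avoids w) xs (λ C → cong ⟦_⟧ ∘ avoids⇒¬perfect C))
        (sumOver-zero (sublists (bfilter (avoids w) xs)))

matching-∷⇒avoids : ∀ {n} {a b : Fin n} {i k} C → isMatching⟨ i , k ⟩ ((a , b) ∷ C) ≡ true →
  all (avoids a) C ≡ true × all (avoids b) C ≡ true
matching-∷⇒avoids {a = a} {b} C q =
  ∧-true (trans (sym (all-not-meets a b C)) (proj₁ (∧-true (proj₁ (∧-true {isMatching ((a , b) ∷ C)} q)))))

-- The added edge must cover exactly the vertices that C leaves uncovered.
perfect-∷-unique : ∀ {n} {a b a′ b′ : Fin n} {j} C → a < b → a′ < b′ →
  isMatching⟨ 0 , j ⟩ ((a , b) ∷ C) ≡ true → isMatching⟨ 0 , j ⟩ ((a′ , b′) ∷ C) ≡ true → (a , b) ≡ (a′ , b′)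
perfect-∷-unique {a = a} {b} {a′} {b′} {j} C a<b a′<b′ q q′ =
  ordered-pair-≡ a<b a′<b′ (covered-by-ab a′ (proj₁ avoids′)) (covered-by-ab b′ (proj₂ avoids′))
  where
  avoids′ : all (avoids a′) C ≡ true × all (avoids b′) C ≡ true
  avoids′ = matching-∷⇒avoids {k = j} C q′
  covered-by-ab : ∀ x → all (avoids x) C ≡ true → x ≡ a ⊎ x ≡ b
  covered-by-ab x avoids-x = covers⇒endpoint a b x
    (md0⇒covers (a , b) C x (isMatching⟨⟩⇒md {k = j} ((a , b) ∷ C) q) (trans (uncovered≡all-avoids C x) avoids-x))

perfect-∷⇒nearlyPerfect : ∀ {n} {a b : Fin n} {k} C → a ≢ b →
  isMatching⟨ 0 , suc k ⟩ ((a , b) ∷ C) ≡ true → isMatching⟨ 2 , k ⟩ C ≡ true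
perfect-∷⇒nearlyPerfect {a = a} {b} C a≢b q =
  proj₂ (∧-true {all (avoids a) C ∧ all (avoids b) C} (trans (sym (isMatching⟨⟩-∷ a≢b C)) q))

covers⇒¬all-avoids : ∀ {n} {e : Edge n} {u} C → covers e u ≡ true → all (avoids u) (e ∷ C) ≡ false
covers⇒¬all-avoids C e-covers-u rewrite e-covers-u = refl

Endpoints : ∀ {n} → Fin n → Fin n → Edge n → Set
Endpoints v u (a , b) = (v ≡ a × u ≡ b) ⊎ (v ≡ b × u ≡ a)

Endpoints⇒covers : ∀ {n} {v u : Fin n} e → Endpoints v u e → covers e u ≡ true
Endpoints⇒covers (a , b) (inj₁ (refl , refl)) rewrite ⌊⌋-yes (b ≟ b) refl = ∨-zeroʳ _
Endpoints⇒covers (a , b) (inj₂ (refl , refl)) rewrite ⌊⌋-yes (a ≟ a) refl = refl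

Endpoints⇒all-avoids : ∀ {n} {v u a b : Fin n} → Endpoints v u (a , b) → ∀ C → all (avoids v) C ≡ true →
  all (avoids a) C ∧ all (avoids b) C ≡ all (avoids u) C
Endpoints⇒all-avoids (inj₁ (refl , refl)) C avoids-v rewrite avoids-v = refl
Endpoints⇒all-avoids (inj₂ (refl , refl)) C avoids-v rewrite avoids-v = ∧-identityʳ _

matchingPoly-sublists : ∀ {n} (G : Graph n) i k →
  matchingPoly G i k ≡ ∑[ A ∈ sublists (edges G) ] ⟦ isMatching⟨ i , k ⟩ A ⟧
matchingPoly-sublists G i k =
  trans (length-bfilter _ (matchings G))
    (trans (sumOver-bfilter _ isMatching (sublists (edges G)))
      (sumOver-cong (sublists (edges G)) (λ A → if⟦⟧≡⟦∧⟧ (isMatching A))))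

-- edges G unfolds to bfilter (isEdge G) (pairs n).
pairs : ∀ n → List (Edge n)
pairs n = concatMap (λ i → map (i ,_) (allFin n)) (allFin n)

isEdge : ∀ {n} → Graph n → Edge n → Bool
isEdge G (i , j) = ⌊ i <? j ⌋ ∧ adj G i j

pairs-unique : ∀ n → Unique (pairs n)
pairs-unique n = subst Unique (sym (as-product (allFin n))) (Unique.cartesianProduct⁺ (Unique.allFin⁺ n) (Unique.allFin⁺ n))
  where
  as-product : ∀ is → concatMap (λ i → map (i ,_) (allFin n)) is ≡ cartesianProduct is (allFin n)
  as-product []       = refl
  as-product (i ∷ is) = cong (map (i ,_) (allFin n) ++_) (as-product is)

edges-unique : ∀ {n} (G : Graph n) → Unique (edges G)
edges-unique {n} G = Unique-bfilter (isEdge G) (pairs-unique n)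

∈-edges⇒< : ∀ {n} (G : Graph n) {a b} → (a , b) ∈ edges G → a < b
∈-edges⇒< {n} G {a} {b} ab∈ = ⌊⌋-yes⁻ (a <? b) (proj₁ (∧-true {⌊ a <? b ⌋} (proj₂ (∈-bfilter⁻ (isEdge G) (pairs n) ab∈))))

allFin-punchIn : ∀ {n} (w : Fin (suc n)) → bfilter (λ j → not ⌊ j ≟ w ⌋) (allFin (suc n)) ≡ map (punchIn w) (allFin n)
allFin-punchIn {n} zero = begin
  bfilter (λ j → not ⌊ j ≟ zero ⌋) (tabulate suc)           ≡⟨ cong (bfilter _) (map-tabulate id suc) ⟨
  bfilter (λ j → not ⌊ j ≟ zero ⌋) (map suc (allFin n))     ≡⟨ bfilter-map _ suc (allFin n) ⟩
  map suc (bfilter (λ _ → true) (allFin n))                 ≡⟨ cong (map suc) (bfilter-true (allFin n)) ⟩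
  map suc (allFin n)                                        ∎
  where open ≡-Reasoning
allFin-punchIn {suc n} (suc w) = cong (zero ∷_) (begin
  bfilter (λ j → not ⌊ j ≟ suc w ⌋) (tabulate suc)          ≡⟨ cong (bfilter _) (map-tabulate id suc) ⟨
  bfilter (λ j → not ⌊ j ≟ suc w ⌋) (map suc (allFin (suc n)))
    ≡⟨ bfilter-map _ suc (allFin (suc n)) ⟩
  map suc (bfilter (λ j → not ⌊ suc j ≟ suc w ⌋) (allFin (suc n)))
    ≡⟨ cong (map suc) (bfilter-cong (allFin (suc n)) (λ j → cong not (≟-punchIn zero j w))) ⟩
  map suc (bfilter (λ j → not ⌊ j ≟ w ⌋) (allFin (suc n)))  ≡⟨ cong (map suc) (allFin-punchIn w) ⟩
  map suc (map (punchIn w) (allFin n))                      ≡⟨ map-∘ (allFin n) ⟨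
  map (punchIn (suc w) ∘ suc) (allFin n)                    ≡⟨ map-tabulate id (punchIn (suc w) ∘ suc) ⟩
  tabulate (punchIn (suc w) ∘ suc)                          ≡⟨ map-tabulate suc (punchIn (suc w)) ⟨
  map (punchIn (suc w)) (tabulate suc)                      ∎)
  where open ≡-Reasoning

punchInEdge : ∀ {n} → Fin (suc n) → Edge n → Edge (suc n)
punchInEdge w (i , j) = punchIn w i , punchIn w j

pairs-avoiding : ∀ {n} (w : Fin (suc n)) → bfilter (avoids w) (pairs (suc n)) ≡ map (punchInEdge w) (pairs n)
pairs-avoiding {n} w = begin
  bfilter (avoids w) (pairs (suc n))
    ≡⟨ bfilter-cong (pairs (suc n)) (λ e → deMorgan₂ ⌊ proj₁ e ≟ w ⌋ ⌊ proj₂ e ≟ w ⌋) ⟩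
  bfilter (λ e → ≠w (proj₁ e) ∧ ≠w (proj₂ e)) (pairs (suc n))
    ≡⟨ bfilter-product ≠w ≠w (allFin (suc n)) (allFin (suc n)) ⟩
  concatMap (λ i → map (i ,_) (bfilter ≠w (allFin (suc n)))) (bfilter ≠w (allFin (suc n)))
    ≡⟨ cong (λ is → concatMap (λ i → map (i ,_) is) is) (allFin-punchIn w) ⟩
  concatMap (λ i → map (i ,_) (map (punchIn w) (allFin n))) (map (punchIn w) (allFin n))
    ≡⟨ concatMap-map _ (punchIn w) (allFin n) ⟩
  concatMap (λ i → map (punchIn w i ,_) (map (punchIn w) (allFin n))) (allFin n)
    ≡⟨ concatMap-cong (λ i → trans (sym (map-∘ (allFin n))) (map-∘ (allFin n))) (allFin n) ⟩
  concatMap (λ i → map (punchInEdge w) (map (i ,_) (allFin n))) (allFin n)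
    ≡⟨ map-concatMap (punchInEdge w) (λ i → map (i ,_) (allFin n)) (allFin n) ⟨
  map (punchInEdge w) (pairs n) ∎
  where
  open ≡-Reasoning
  ≠w : Fin (suc n) → Bool
  ≠w j = not ⌊ j ≟ w ⌋

edges-delete : ∀ {n} (G : Graph (suc n)) w → map (punchInEdge w) (edges (delete G w)) ≡ bfilter (avoids w) (edges G)
edges-delete {n} G w = begin
  map (punchInEdge w) (bfilter (isEdge (delete G w)) (pairs n))
    ≡⟨ cong (map (punchInEdge w)) (bfilter-cong (pairs n) (λ (i , j) →
         cong (_∧ adj G (punchIn w i) (punchIn w j)) (sym (<?-punchIn w i j)))) ⟩
  map (punchInEdge w) (bfilter (isEdge G ∘ punchInEdge w) (pairs n))
    ≡⟨ bfilter-map (isEdge G) (punchInEdge w) (pairs n) ⟨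
  bfilter (isEdge G) (map (punchInEdge w) (pairs n))
    ≡⟨ cong (bfilter (isEdge G)) (pairs-avoiding w) ⟨
  bfilter (isEdge G) (bfilter (avoids w) (pairs (suc n)))
    ≡⟨ bfilter-comm (isEdge G) (avoids w) (pairs (suc n)) ⟩
  bfilter (avoids w) (edges G) ∎
  where open ≡-Reasoning

incident-split : ∀ {n} (G : Graph n) v i j →
  (if isEdge G (i , j) then ⟦ covers (i , j) v ⟧ else 0)
    ≡ (if ⌊ v ≟ i ⌋ then ⟦ ⌊ v <? j ⌋ ∧ adj G v j ⟧ else 0) + (if ⌊ v ≟ j ⌋ then ⟦ ⌊ i <? v ⌋ ∧ adj G v i ⟧ else 0)
incident-split G v i j rewrite ≟-sym v i | ≟-sym v j with i ≟ v | j ≟ v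
... | yes refl | yes refl rewrite ⌊⌋-no (v <? v) (<-irrefl refl) = refl
... | yes refl | no _     = sym (+-identityʳ _)
... | no _     | yes refl = cong (λ b → ⟦ ⌊ i <? v ⌋ ∧ b ⟧) (Graph.sym G i v)
... | no _     | no _     with isEdge G (i , j)
...   | true  = refl
...   | false = refl

adj-oriented : ∀ {n} (G : Graph n) v j → ⟦ ⌊ v <? j ⌋ ∧ adj G v j ⟧ + ⟦ ⌊ j <? v ⌋ ∧ adj G v j ⟧ ≡ ⟦ adj G v j ⟧
adj-oriented G v j with <-cmp v j
... | tri< v<j _ v≯j rewrite ⌊⌋-yes (v <? j) v<j | ⌊⌋-no (j <? v) v≯j = +-identityʳ _
... | tri≈ _ refl _  rewrite ⌊⌋-no (v <? v) (<-irrefl refl) | Graph.irrefl G v = refl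
... | tri> v≮j _ v>j rewrite ⌊⌋-no (v <? j) v≮j | ⌊⌋-yes (j <? v) v>j = refl

-- An edge (i , j) with i < j meets v either at its smaller end (X) or at its larger end (Y).
sumOver-edges-covers : ∀ {n} (G : Graph n) v → ∑[ e ∈ edges G ] ⟦ covers e v ⟧ ≡ degree G v
sumOver-edges-covers {n} G v = begin
  ∑[ e ∈ edges G ] ⟦ covers e v ⟧
    ≡⟨ sumOver-bfilter _ (isEdge G) (pairs n) ⟩
  ∑[ e ∈ pairs n ] incident e
    ≡⟨ sumOver-concatMap incident (λ i → map (i ,_) (allFin n)) (allFin n) ⟩
  ∑[ i ∈ allFin n ] sumOver incident (map (i ,_) (allFin n))
    ≡⟨ sumOver-cong (allFin n) (λ i → trans (sumOver-map incident (i ,_) (allFin n))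
                                           (trans (sumOver-cong (allFin n) (incident-split G v i))
                                                  (sumOver-distrib-+ _ _ (allFin n)))) ⟩
  ∑[ i ∈ allFin n ] (∑[ j ∈ allFin n ] (if ⌊ v ≟ i ⌋ then X j else 0) + ∑[ j ∈ allFin n ] (if ⌊ v ≟ j ⌋ then Y i else 0))
    ≡⟨ sumOver-distrib-+ _ _ (allFin n) ⟩
  ∑[ i ∈ allFin n ] ∑[ j ∈ allFin n ] (if ⌊ v ≟ i ⌋ then X j else 0)
    + ∑[ i ∈ allFin n ] ∑[ j ∈ allFin n ] (if ⌊ v ≟ j ⌋ then Y i else 0)
    ≡⟨ cong₂ _+_ (trans (sumOver-comm _ (allFin n) (allFin n)) (sumOver-cong (allFin n) (λ j → sumOver-allFin-single v (λ _ → X j))))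
                 (sumOver-cong (allFin n) (λ i → sumOver-allFin-single v (λ _ → Y i))) ⟩
  sumOver X (allFin n) + sumOver Y (allFin n)
    ≡⟨ sumOver-distrib-+ X Y (allFin n) ⟨
  ∑[ j ∈ allFin n ] (X j + Y j)
    ≡⟨ sumOver-cong (allFin n) (adj-oriented G v) ⟩
  ∑[ j ∈ allFin n ] ⟦ adj G v j ⟧
    ≡⟨ sum-map _ (allFin n) ⟨
  degree G v ∎
  where
  open ≡-Reasoning
  incident : Edge n → ℕ
  incident e = if isEdge G e then ⟦ covers e v ⟧ else 0
  X Y : Fin n → ℕ
  X j = ⟦ ⌊ v <? j ⌋ ∧ adj G v j ⟧
  Y j = ⟦ ⌊ j <? v ⌋ ∧ adj G v j ⟧

-- Vertex-deleted subgraphs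

module _ {n} (w : Fin (suc n)) where

  covers-punchInEdge : ∀ (e : Edge n) x → covers (punchInEdge w e) (punchIn w x) ≡ covers e x
  covers-punchInEdge (i , j) x = cong₂ _∨_ (≟-punchIn w i x) (≟-punchIn w j x)

  covers-punchInEdge-w : ∀ (e : Edge n) → covers (punchInEdge w e) w ≡ false
  covers-punchInEdge-w (i , j) =
    cong₂ _∨_ (⌊⌋-no (punchIn w i ≟ w) (punchInᵢ≢i w i)) (⌊⌋-no (punchIn w j ≟ w) (punchInᵢ≢i w j))

  isMatching-map-punchInEdge : ∀ A → isMatching (map (punchInEdge w) A) ≡ isMatching A
  isMatching-map-punchInEdge []      = refl
  isMatching-map-punchInEdge (e ∷ A) =
    cong₂ _∧_ (trans (all-map _ (punchInEdge w) A)
                     (all-cong A (λ (k , l) → cong not (cong₂ _∨_ (covers-punchInEdge e k) (covers-punchInEdge e l)))))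
              (isMatching-map-punchInEdge A)

  md-map-punchInEdge : ∀ A → md (map (punchInEdge w) A) ≡ suc (md A)
  md-map-punchInEdge A = begin
    md (map (punchInEdge w) A)
      ≡⟨ md-sum (map (punchInEdge w) A) ⟩
    ∑[ x ∈ allFin (suc n) ] ⟦ uncovered (map (punchInEdge w) A) x ⟧
      ≡⟨ sumOver-allFin-punchIn w _ ⟩
    ⟦ uncovered (map (punchInEdge w) A) w ⟧ + ∑[ x ∈ allFin n ] ⟦ uncovered (map (punchInEdge w) A) (punchIn w x) ⟧
      ≡⟨ cong₂ _+_ (cong (⟦_⟧ ∘ not) (trans (any-map _ (punchInEdge w) A)
                                            (trans (any-cong A covers-punchInEdge-w) (any-false A))))
                   (sumOver-cong (allFin n) (λ x → cong (⟦_⟧ ∘ not) (trans (any-map _ (punchInEdge w) A)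
                                                                           (any-cong A (λ e → covers-punchInEdge e x))))) ⟩
    1 + ∑[ x ∈ allFin n ] ⟦ uncovered A x ⟧
      ≡⟨ cong suc (md-sum A) ⟨
    suc (md A) ∎
    where open ≡-Reasoning

matchingPoly-delete : ∀ {n} (G : Graph (suc n)) w i k →
  matchingPoly (delete G w) i k ≡ ∑[ A ∈ sublists (bfilter (avoids w) (edges G)) ] ⟦ isMatching⟨ suc i , k ⟩ A ⟧
matchingPoly-delete {n} G w i k = begin
  matchingPoly (delete G w) i k
    ≡⟨ matchingPoly-sublists (delete G w) i k ⟩
  ∑[ A ∈ sublists (edges (delete G w)) ] ⟦ isMatching⟨ i , k ⟩ A ⟧
    ≡⟨ sumOver-cong (sublists (edges (delete G w))) transported ⟨
  ∑[ A ∈ sublists (edges (delete G w)) ] lifted (map (punchInEdge w) A)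
    ≡⟨ sumOver-map lifted (map (punchInEdge w)) (sublists (edges (delete G w))) ⟨
  sumOver lifted (map (map (punchInEdge w)) (sublists (edges (delete G w))))
    ≡⟨ cong (sumOver lifted) (sublists-map (punchInEdge w) (edges (delete G w))) ⟨
  sumOver lifted (sublists (map (punchInEdge w) (edges (delete G w))))
    ≡⟨ cong (sumOver lifted ∘ sublists) (edges-delete G w) ⟩
  sumOver lifted (sublists (bfilter (avoids w) (edges G))) ∎
  where
  open ≡-Reasoning
  lifted : List (Edge (suc n)) → ℕ
  lifted A = ⟦ isMatching⟨ suc i , k ⟩ A ⟧
  transported : ∀ A → lifted (map (punchInEdge w) A) ≡ ⟦ isMatching⟨ i , k ⟩ A ⟧
  transported A = cong ⟦_⟧ (cong₂ _∧_ (isMatching-map-punchInEdge w A)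
    (cong₂ (λ a b → (a ≡ᵇ suc i) ∧ (b ≡ᵇ k)) (md-map-punchInEdge w A) (length-map (punchInEdge w) A)))

matchingPoly-delete-∧ : ∀ {n} (G : Graph (suc n)) w i k →
  matchingPoly (delete G w) i k ≡ ∑[ A ∈ sublists (edges G) ] ⟦ all (avoids w) A ∧ isMatching⟨ suc i , k ⟩ A ⟧
matchingPoly-delete-∧ G w i k = trans (matchingPoly-delete G w i k)
  (trans (sumOver-sublists-bfilter (avoids w) (⟦_⟧ ∘ isMatching⟨ suc i , k ⟩) (edges G))
    (sumOver-cong (sublists (edges G)) (λ A → if⟦⟧≡⟦∧⟧ (all (avoids w) A))))

-- Summing over the deck

sumOver-allFin-avoids : ∀ {n} (A : List (Edge n)) → ∑[ w ∈ allFin n ] ⟦ all (avoids w) A ⟧ ≡ md A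
sumOver-allFin-avoids {n} A =
  trans (sumOver-cong (allFin n) (λ w → cong ⟦_⟧ (sym (uncovered≡all-avoids A w)))) (sym (md-sum A))

sumOver-deck : ∀ {n} (G : Graph (suc n)) i k →
  ∑[ w ∈ allFin (suc n) ] matchingPoly (delete G w) i k ≡ suc i * matchingPoly G (suc i) k
sumOver-deck {n} G i k = begin
  ∑[ w ∈ allFin (suc n) ] matchingPoly (delete G w) i k
    ≡⟨ sumOver-cong (allFin (suc n)) (λ w → matchingPoly-delete-∧ G w i k) ⟩
  ∑[ w ∈ allFin (suc n) ] ∑[ A ∈ sublists (edges G) ] ⟦ all (avoids w) A ∧ counted A ⟧
    ≡⟨ sumOver-comm (λ w A → ⟦ all (avoids w) A ∧ counted A ⟧) (allFin (suc n)) (sublists (edges G)) ⟩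
  ∑[ A ∈ sublists (edges G) ] ∑[ w ∈ allFin (suc n) ] ⟦ all (avoids w) A ∧ counted A ⟧
    ≡⟨ sumOver-cong (sublists (edges G)) cards-containing ⟩
  ∑[ A ∈ sublists (edges G) ] (suc i * ⟦ counted A ⟧)
    ≡⟨ sumOver-*ˡ (suc i) (⟦_⟧ ∘ counted) (sublists (edges G)) ⟩
  suc i * ∑[ A ∈ sublists (edges G) ] ⟦ counted A ⟧
    ≡⟨ cong (suc i *_) (matchingPoly-sublists G (suc i) k) ⟨
  suc i * matchingPoly G (suc i) k ∎
  where
  open ≡-Reasoning
  counted : List (Edge (suc n)) → Bool
  counted = isMatching⟨ suc i , k ⟩
  cards-containing : ∀ A → ∑[ w ∈ allFin (suc n) ] ⟦ all (avoids w) A ∧ counted A ⟧ ≡ suc i * ⟦ counted A ⟧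
  cards-containing A with counted A in q
  ... | false = trans (sumOver-cong (allFin (suc n)) (λ w → cong ⟦_⟧ (∧-zeroʳ _)))
                      (trans (sumOver-zero (allFin (suc n))) (sym (*-zeroʳ (suc i))))
  ... | true  = trans (sumOver-cong (allFin (suc n)) (λ w → cong ⟦_⟧ (∧-identityʳ _)))
                      (trans (sumOver-allFin-avoids A) (trans (isMatching⟨⟩⇒md A q) (sym (*-identityʳ (suc i)))))

sameDeck⇒positive-coefficients : ∀ {n m} (G : Graph (suc n)) (H : Graph (suc m)) → SameDeck G H →
  ∀ i k → matchingPoly G (suc i) k ≡ matchingPoly H (suc i) k
sameDeck⇒positive-coefficients {n} {m} G H (σ , same-cards) i k = *-cancelˡ-≡ _ _ (suc i) (begin
  suc i * matchingPoly G (suc i) k                           ≡⟨ sumOver-deck G i k ⟨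
  ∑[ w ∈ allFin (suc n) ] matchingPoly (delete G w) i k      ≡⟨ sumOver-cong (allFin (suc n)) (λ w → same-cards w i k) ⟩
  ∑[ w ∈ allFin (suc n) ] matchingPoly (delete H (Inverse.to σ w)) i k
                                                             ≡⟨ sumOver-allFin-permute σ (λ x → matchingPoly (delete H x) i k) ⟩
  ∑[ x ∈ allFin (suc m) ] matchingPoly (delete H x) i k      ≡⟨ sumOver-deck H i k ⟩
  suc i * matchingPoly H (suc i) k                           ∎)
  where open ≡-Reasoning

-- Perfect matchings

matchingPoly-0-0 : ∀ {n} (G : Graph (suc n)) → matchingPoly G 0 0 ≡ 0
matchingPoly-0-0 {n} G = trans (matchingPoly-sublists G 0 0)
  (trans (sumOver-cong (sublists (edges G)) empty-not-perfect) (sumOver-zero (sublists (edges G))))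
  where
  empty-not-perfect : ∀ (A : List (Edge (suc n))) → ⟦ isMatching⟨ 0 , 0 ⟩ A ⟧ ≡ 0
  empty-not-perfect []      with md {suc n} [] ≡ᵇ 0 in e
  ... | true  = ⊥-elim (uncovered⇒md≢0 {suc n} [] zero refl (≡ᵇ-true e))
  ... | false = refl
  empty-not-perfect (e ∷ A) = cong ⟦_⟧ (trans (cong (isMatching (e ∷ A) ∧_) (∧-zeroʳ _)) (∧-zeroʳ _))

matchingPoly-0-suc≤delete : ∀ {n} (G : Graph (suc n)) k w → matchingPoly G 0 (suc k) ≤ matchingPoly (delete G w) 1 k
matchingPoly-0-suc≤delete {n} G k w = begin
  matchingPoly G 0 (suc k)
    ≡⟨ matchingPoly-sublists G 0 (suc k) ⟩
  sumOver perfect (sublists (edges G))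
    ≡⟨ sumOver-sublists-↭ (↭-bfilter-split at-w (edges G)) perfect (cong ⟦_⟧ ∘ isMatching⟨⟩-↭ 0 (suc k)) ⟩
  sumOver perfect (sublists (E ++ R))
    ≡⟨ sumOver-sublists-++ perfect E R ⟩
  ∑[ B ∈ sublists E ] ∑[ C ∈ sublists R ] perfect (B ++ C)
    ≡⟨ sumOver-sublists-bfilter-singletons at-w _ (edges G) only-single-edges-at-w ⟩
  ∑[ e ∈ E ] ∑[ C ∈ sublists R ] perfect (e ∷ C)
    ≡⟨ sumOver-comm (λ e C → perfect (e ∷ C)) E (sublists R) ⟩
  ∑[ C ∈ sublists R ] ∑[ e ∈ E ] perfect (e ∷ C)
    ≤⟨ sumOver-sublists-bfilter-mono (avoids w) (edges G) at-most-one-completion ⟩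
  ∑[ C ∈ sublists R ] ⟦ isMatching⟨ 2 , k ⟩ C ⟧
    ≡⟨ matchingPoly-delete G w 1 k ⟨
  matchingPoly (delete G w) 1 k ∎
  where
  open ≤-Reasoning
  perfect : List (Edge (suc n)) → ℕ
  perfect A = ⟦ isMatching⟨ 0 , suc k ⟩ A ⟧
  at-w : Edge (suc n) → Bool
  at-w e = covers e w
  E R : List (Edge (suc n))
  E = bfilter at-w (edges G)
  R = bfilter (avoids w) (edges G)
  only-single-edges-at-w : ∀ B → all at-w B ≡ true → length B ≢ 1 → ∑[ C ∈ sublists R ] perfect (B ++ C) ≡ 0
  only-single-edges-at-w []          _  _  = sumOver-sublists-avoiding-¬perfect w (suc k) (edges G)
  only-single-edges-at-w (e ∷ [])    _  ≢1 = ⊥-elim (≢1 refl)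
  only-single-edges-at-w (e ∷ f ∷ B) at ≢1 with ∧-true at
  ... | e-at , f-at = trans (sumOver-cong (sublists R) (λ C → cong ⟦_⟧ (meets⇒¬isMatching⟨⟩ e f 0 (suc k) (B ++ C) e-meets-f)))
                            (sumOver-zero (sublists R))
    where
    e-meets-f : meets e f ≡ true
    e-meets-f = meets-at e f w e-at (proj₁ (∧-true f-at))
  at-most-one-completion : ∀ C → all (avoids w) C ≡ true → ∑[ e ∈ E ] perfect (e ∷ C) ≤ ⟦ isMatching⟨ 2 , k ⟩ C ⟧
  at-most-one-completion C _ =
    sumOver-≤-atMostOne (λ e → isMatching⟨ 0 , suc k ⟩ (e ∷ C)) _ (Unique-bfilter at-w (edges-unique G))
      (λ { {a , b} e∈ → perfect-∷⇒nearlyPerfect C (<⇒≢ (ordered e∈)) })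
      (λ { {a , b} {a′ , b′} e∈ e′∈ → perfect-∷-unique {j = suc k} C (ordered e∈) (ordered e′∈) })
    where
    ordered : ∀ {a b} → (a , b) ∈ E → a < b
    ordered e∈ = ∈-edges⇒< G (proj₁ (∈-bfilter⁻ at-w (edges G) e∈))

pendant⇒sole-edge : ∀ {n} (G : Graph n) v → degree G v ≡ 1 →
  Σ (Edge n) λ e → bfilter (λ f → covers f v) (edges G) ≡ [ e ]
pendant⇒sole-edge G v deg≡1
  with bfilter (λ f → covers f v) (edges G) | trans (length-bfilter _ (edges G)) (trans (sumOver-edges-covers G v) deg≡1)
... | []        | ()
... | e ∷ []    | _  = e , refl
... | _ ∷ _ ∷ _ | ()

sole-edge⇒matchingPoly-0-suc≡delete : ∀ {n} (G : Graph (suc n)) k {a b v u : Fin (suc n)} → a ≢ b →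
  Endpoints v u (a , b) → bfilter (λ e → covers e v) (edges G) ≡ [ (a , b) ] →
  matchingPoly G 0 (suc k) ≡ matchingPoly (delete G u) 1 k
sole-edge⇒matchingPoly-0-suc≡delete G k {a} {b} {v} {u} a≢b endpoints sole = begin
  matchingPoly G 0 (suc k)
    ≡⟨ matchingPoly-sublists G 0 (suc k) ⟩
  sumOver perfect (sublists (edges G))
    ≡⟨ sumOver-sublists-↭ split perfect (cong ⟦_⟧ ∘ isMatching⟨⟩-↭ 0 (suc k)) ⟩
  sumOver perfect (sublists ((a , b) ∷ R))
    ≡⟨ sumOver-sublists-∷ perfect (a , b) R ⟩
  sumOver perfect (sublists R) + ∑[ C ∈ sublists R ] perfect ((a , b) ∷ C)
    ≡⟨ cong₂ _+_ (sumOver-sublists-avoiding-¬perfect v (suc k) (edges G))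
                 (sumOver-sublists-bfilter-cong (avoids v) (edges G) completes) ⟩
  sumOver card (sublists R)
    ≡⟨ +-identityʳ _ ⟨
  sumOver card (sublists R) + 0
    ≡⟨ cong (sumOver card (sublists R) +_) (trans (sumOver-cong (sublists R) not-avoiding-u) (sumOver-zero (sublists R))) ⟨
  sumOver card (sublists R) + ∑[ C ∈ sublists R ] card ((a , b) ∷ C)
    ≡⟨ sumOver-sublists-∷ card (a , b) R ⟨
  sumOver card (sublists ((a , b) ∷ R))
    ≡⟨ sumOver-sublists-↭ split card (λ A↭B → cong₂ (λ p q → ⟦ p ∧ q ⟧) (all-↭ (avoids u) A↭B)
                                                                      (isMatching⟨⟩-↭ 2 k A↭B)) ⟨
  sumOver card (sublists (edges G))
    ≡⟨ matchingPoly-delete-∧ G u 1 k ⟨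
  matchingPoly (delete G u) 1 k ∎
  where
  open ≡-Reasoning
  R : List (Edge (suc _))
  R = bfilter (avoids v) (edges G)
  perfect card : List (Edge (suc _)) → ℕ
  perfect A = ⟦ isMatching⟨ 0 , suc k ⟩ A ⟧
  card A = ⟦ all (avoids u) A ∧ isMatching⟨ 2 , k ⟩ A ⟧
  split : edges G ↭ (a , b) ∷ R
  split = subst (λ L → edges G ↭ L ++ R) sole (↭-bfilter-split (λ e → covers e v) (edges G))
  not-avoiding-u : ∀ C → card ((a , b) ∷ C) ≡ 0
  not-avoiding-u C = cong (λ p → ⟦ p ∧ isMatching⟨ 2 , k ⟩ ((a , b) ∷ C) ⟧)
    (covers⇒¬all-avoids {e = a , b} {u} C (Endpoints⇒covers (a , b) endpoints))
  completes : ∀ C → all (avoids v) C ≡ true → perfect ((a , b) ∷ C) ≡ card C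
  completes C avoids-v = cong ⟦_⟧ (trans (isMatching⟨⟩-∷ a≢b C)
    (cong (_∧ isMatching⟨ 2 , k ⟩ C) (Endpoints⇒all-avoids endpoints C avoids-v)))

pendant⇒matchingPoly-0-suc≡delete : ∀ {n} (G : Graph (suc n)) k → HasPendant G →
  Σ (Fin (suc n)) λ u → matchingPoly G 0 (suc k) ≡ matchingPoly (delete G u) 1 k
pendant⇒matchingPoly-0-suc≡delete G k (v , deg≡1) with pendant⇒sole-edge G v deg≡1
... | (a , b) , sole with ∈-bfilter⁻ (λ e → covers e v) (edges G) (subst ((a , b) ∈_) (sym sole) (here refl))
... | ab∈ , ab-covers-v with covers⇒endpoint a b v ab-covers-v
... | inj₁ v≡a = b , sole-edge⇒matchingPoly-0-suc≡delete G k (<⇒≢ (∈-edges⇒< G ab∈)) (inj₁ (v≡a , refl)) sole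
... | inj₂ v≡b = a , sole-edge⇒matchingPoly-0-suc≡delete G k (<⇒≢ (∈-edges⇒< G ab∈)) (inj₂ (v≡b , refl)) sole

sameDeck-sym : ∀ {n m} (G : Graph (suc n)) (H : Graph (suc m)) → SameDeck G H → SameDeck H G
sameDeck-sym G H (σ , same-cards) = ↔-sym σ , λ x i k →
  sym (trans (same-cards (Inverse.from σ x) i k) (cong (λ y → matchingPoly (delete H y) i k) (Inverse.strictlyInverseˡ σ x)))

sameDeck⇒matchingPoly-0-suc≤ : ∀ {n m} (G : Graph (suc n)) (H : Graph (suc m)) → SameDeck G H → HasPendant H →
  ∀ k → matchingPoly G 0 (suc k) ≤ matchingPoly H 0 (suc k)
sameDeck⇒matchingPoly-0-suc≤ G H (σ , same-cards) pendant k with pendant⇒matchingPoly-0-suc≡delete H k pendant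
... | u , H-perfect≡card = begin
  matchingPoly G 0 (suc k)
    ≤⟨ matchingPoly-0-suc≤delete G k w ⟩
  matchingPoly (delete G w) 1 k
    ≡⟨ same-cards w 1 k ⟩
  matchingPoly (delete H (Inverse.to σ w)) 1 k
    ≡⟨ cong (λ y → matchingPoly (delete H y) 1 k) (Inverse.strictlyInverseˡ σ u) ⟩
  matchingPoly (delete H u) 1 k
    ≡⟨ H-perfect≡card ⟨
  matchingPoly H 0 (suc k) ∎
  where
  open ≤-Reasoning
  w : Fin _
  w = Inverse.from σ u

mainTheorem4 : ∀ {n m} (G : Graph (suc n)) (H : Graph (suc m)) →
    HasPendant G → HasPendant H → SameDeck G H →
    matchingPoly G ≈P matchingPoly H
mainTheorem4 G H _           _           deck (suc i) k       = sameDeck⇒positive-coefficients G H deck i k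
mainTheorem4 G H _           _           _    zero    zero    = trans (matchingPoly-0-0 G) (sym (matchingPoly-0-0 H))
mainTheorem4 G H G-pendant H-pendant deck zero    (suc k) =
  ≤-antisym (sameDeck⇒matchingPoly-0-suc≤ G H deck H-pendant k)
            (sameDeck⇒matchingPoly-0-suc≤ H G (sameDeck-sym G H deck) G-pendant k)
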